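{- Let $\mathcal F$ be a non-empty finite set of finite tournaments, each with at least two vertices, and let $m$ be the minimum number of vertices of a tournament in $\mathcal F$. The following are equivalent. (1) An oriented graph is $\mathcal F$-free if and only if it contains no tournament on $m$ vertices. (2) For every digraph $D$, there is an $\mathcal F$-free orientation completion of $D$ if and only if every orientation completion of $D$ is $\mathcal F$-free. (3) For every digraph $D$, if a pair $(x,y)$ forces a pair $(u,v)$ in $D$ with respect to $\mathcal F$, then $x=u$ and $y=v$. (4) For every semicomplete digraph $D$ on $m$ vertices, if a pair $(x,y)$ forces a pair $(u,v)$ in $D$ with respect to $\mathcal F$, then $x=u$ and $y=v$.
   Context: Digraphs are loopless, finite here. A symmetric edge $xy$ of a digraph $D$ is a pair of vertices with $(x,y),(y,x)\in E(D)$. An oriented graph has no symmetric edge; a tournament is an oriented graph in which every two distinct vertices are adjacent; a digraph is semicomplete if every two distinct vertices are joined by at least one edge. An oriented graph is $\mathcal F$-free if no tournament of $\mathcal F$ embeds into it as an induced subdigraph. An orientation completion of a digraph $D$ is an oriented graph obtained from $D$ by removing, from each symmetric edge, exactly one of its two directions. For an edge $(x,y)$, $D-(x,y)$ denotes $D$ with the edge $(x,y)$ removed. A symmetric edge $xy$ of $D$ is free (with respect to $\mathcal F$) if both $D-(x,y)$ and $D-(y,x)$ have an $\mathcal F$-free orientation completion. A pair $(x,y)$ forces a pair $(u,v)$ in $D$ (with respect to $\mathcal F$) if $xy$ and $uv$ are free symmetric edges of $D$ and every $\mathcal F$-free orientation completion of $D-(y,x)$ contains $(u,v)$ as an edge.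 -}

module Defs where

open import Data.Nat using (ℕ; _≤_)
open import Data.Fin using (Fin; _≟_)
open import Data.Bool using (Bool; true; false; _∧_; if_then_else_)
open import Data.List using (List; [])
open import Data.List.Relation.Unary.All using (All)
open import Data.List.Relation.Unary.Any using (Any)
open import Data.Product using (Σ; ∃; _×_; _,_; proj₁; proj₂)
open import Data.Sum using (_⊎_)
open import Relation.Binary.PropositionalEquality using (_≡_; _≢_)
open import Relation.Nullary using (¬_; does)
open import Function.Definitions using (Injective)
open import Function.Bundles using (_⇔_)

-- A (finite) digraph on vertex set Fin n, given by its adjacency predicate:
-- D x y ≡ true  means  (x , y) ∈ E(D).
Digraph : ℕ → Set
Digraph n = Fin n → Fin n → Bool

Loopless : ∀ {n} → Digraph n → Set
Loopless D = ∀ x → D x x ≡ false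

SymEdge : ∀ {n} → Digraph n → Fin n → Fin n → Set
SymEdge D x y = D x y ≡ true × D y x ≡ true

Oriented : ∀ {n} → Digraph n → Set
Oriented D = Loopless D × (∀ x y → ¬ SymEdge D x y)

IsTournament : ∀ {n} → Digraph n → Set
IsTournament D = Oriented D × (∀ x y → x ≢ y → D x y ≡ true ⊎ D y x ≡ true)

Semicomplete : ∀ {n} → Digraph n → Set
Semicomplete D = Loopless D × (∀ x y → x ≢ y → D x y ≡ true ⊎ D y x ≡ true)

InducedEmbeds : ∀ {k n} → Digraph k → Digraph n → Set
InducedEmbeds {k} {n} T D =
  Σ (Fin k → Fin n) λ f → Injective _≡_ _≡_ f × (∀ i j → i ≢ j → T i j ≡ D (f i) (f j))

Family : Set
Family = List (Σ ℕ Digraph)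

FFree : ∀ {n} → Family → Digraph n → Set
FFree F O = All (λ T → ¬ InducedEmbeds (proj₂ T) O) F

IsOrientationCompletion : ∀ {n} → Digraph n → Digraph n → Set
IsOrientationCompletion D O =
  (∀ x y → D x y ≡ false → O x y ≡ false) ×
  (∀ x y → D x y ≡ true → D y x ≡ false → O x y ≡ true) ×
  (∀ x y → SymEdge D x y →
     (O x y ≡ true × O y x ≡ false) ⊎ (O x y ≡ false × O y x ≡ true))

HasFFreeOC : ∀ {n} → Family → Digraph n → Set
HasFFreeOC F D = Σ (Digraph _) λ O → IsOrientationCompletion D O × FFree F O

removeEdge : ∀ {n} → Digraph n → Fin n → Fin n → Digraph n
removeEdge D x y a b = if does (a ≟ x) ∧ does (b ≟ y) then false else D a b

Free : ∀ {n} → Family → Digraph n → Fin n → Fin n → Set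
Free F D x y =
  SymEdge D x y × HasFFreeOC F (removeEdge D x y) × HasFFreeOC F (removeEdge D y x)

Forces : ∀ {n} → Family → Digraph n → Fin n → Fin n → Fin n → Fin n → Set
Forces F D x y u v =
  Free F D x y × Free F D u v ×
  (∀ O → IsOrientationCompletion (removeEdge D y x) O → FFree F O → O u v ≡ true)

Cond1 : Family → ℕ → Set
Cond1 F m = ∀ n (O : Digraph n) → Oriented O →
  (FFree F O ⇔ (∀ (T : Digraph m) → IsTournament T → ¬ InducedEmbeds T O))

Cond2 : Family → Set
Cond2 F = ∀ n (D : Digraph n) → Loopless D →
  (HasFFreeOC F D ⇔ (∀ O → IsOrientationCompletion D O → FFree F O))

Cond3 : Family → Set
Cond3 F = ∀ n (D : Digraph n) → Loopless D → ∀ x y u v →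
  Forces F D x y u v → x ≡ u × y ≡ v

Cond4 : Family → ℕ → Set
Cond4 F m = ∀ (D : Digraph m) → Semicomplete D → ∀ x y u v →
  Forces F D x y u v → x ≡ u × y ≡ v

{-# OPTIONS --safe #-}
module Submission where

-- All orientation completions of a digraph have the same adjacencies, so one of them contains
-- a tournament on m vertices iff all do; this gives (1) ⇒ (2).  Under (2) a forced pair (u, v)
-- other than (x, y) is absurd, since some orientation completion of D - (y, x) avoids (u, v)
-- and is F-free.  For (4) ⇒ (1), suppose some tournament T on m vertices is F-free and let R
-- be a member of F on m vertices.  In the complete symmetric digraph on m vertices every
-- symmetric edge is free (relabel T).  Deleting, one at a time, the reverse of every edge of R
-- keeps all remaining symmetric edges free, because a newly non-free edge would be forced, which
-- (4) forbids.  The process ends at R itself, which therefore has an F-free orientation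
-- completion, i.e. R is F-free: a contradiction.  The converse half of (1) holds because every
-- member of F has at least m vertices.

open import Defs
open import Data.Nat using (ℕ; _≤_; s≤s)
open import Data.List using (List; []; _∷_; foldr; cartesianProduct; allFin)
open import Data.List.Relation.Unary.All using (All)
import Data.List.Relation.Unary.All as All
open import Data.List.Relation.Unary.Any using (Any; here; there)
open import Data.List.Membership.Propositional using (_∈_; find)
open import Data.List.Membership.Propositional.Properties using (∈-cartesianProduct⁺; ∈-allFin)
open import Data.Product using (Σ; _×_; proj₁; proj₂; _,_)
import Data.Product as Product
open import Data.Product.Properties using (≡-dec)
open import Data.Sum using (_⊎_; inj₁; inj₂)
import Data.Sum as Sum
open import Data.Bool using (true; false; not; _∧_; _∨_)
open import Data.Fin using (Fin; _≟_; zero; suc; inject≤)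
open import Data.Fin.Properties using (_<?_; <-cmp; inject≤-injective)
import Data.Fin.Permutation.Components as PC
open import Data.Empty using (⊥-elim)
open import Function using (_∘_; id)
open import Function.Bundles using (_⇔_; mk⇔; Equivalence)
open import Function.Definitions using (Injective)
open import Relation.Binary.Definitions using (DecidableEquality; tri<; tri≈; tri>)
open import Relation.Binary.PropositionalEquality using (_≡_; _≢_; refl; sym; trans; cong)
open import Relation.Nullary using (¬_; yes; no; does)
open import Relation.Nullary.Decidable using (dec-true; dec-false)
open import Relation.Nullary.Negation using (¬¬-map)

private
  variable
    n m k : ℕ
    F : Family
    D E O T R : Digraph n
    a b x y u v : Fin n

OneWay : Digraph n → Fin n → Fin n → Set
OneWay O x y = (O x y ≡ true × O y x ≡ false) ⊎ (O x y ≡ false × O y x ≡ true)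

_⊆ᴰ_ : Digraph n → Digraph n → Set
D ⊆ᴰ E = ∀ x y → D x y ≡ true → E x y ≡ true

≡true⇒≢false : ∀ {c} → c ≡ true → c ≢ false
≡true⇒≢false refl ()

⊆ᴰ-false : D ⊆ᴰ E → E x y ≡ false → D x y ≡ false
⊆ᴰ-false {D = D} {x = x} {y = y} D⊆E e with D x y in d
... | false = refl
... | true  = ⊥-elim (≡true⇒≢false (D⊆E x y d) e)

symEdge-≢ : Loopless D → SymEdge D x y → x ≢ y
symEdge-≢ ℓ (dxy , _) refl = ≡true⇒≢false dxy (ℓ _)

oriented-asym : Oriented O → O y x ≡ true → O x y ≡ false
oriented-asym {O = O} {y = y} {x = x} (_ , noSym) oyx with O x y in oxy
... | false = refl
... | true  = ⊥-elim (noSym x y (oxy , oyx))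

tournament-oneWay : IsTournament T → x ≢ y → OneWay T x y
tournament-oneWay {T = T} {x = x} {y = y} ((_ , noSym) , adj) x≢y with T x y in txy | T y x in tyx
... | true  | true  = ⊥-elim (noSym x y (txy , tyx))
... | true  | false = inj₁ (refl , refl)
... | false | true  = inj₂ (refl , refl)
... | false | false with adj x y x≢y
...   | inj₁ t = ⊥-elim (≡true⇒≢false t txy)
...   | inj₂ t = ⊥-elim (≡true⇒≢false t tyx)

tournament-edge : IsTournament T → 2 ≤ n → Σ (Fin n) λ p → Σ (Fin n) λ q → T p q ≡ true
tournament-edge (_ , adj) (s≤s (s≤s _)) with adj zero (suc zero) (λ ())
... | inj₁ t = zero , suc zero , t
... | inj₂ t = suc zero , zero , t

tournament-⊆-oriented : IsTournament R → Oriented O → R ⊆ᴰ O → ∀ p q → R p q ≡ O p q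
tournament-⊆-oriented tR orO R⊆O p q with p ≟ q
... | yes refl = trans (proj₁ (proj₁ tR) p) (sym (proj₁ orO p))
... | no p≢q with tournament-oneWay tR p≢q
...   | inj₁ (rpq , _)   = trans rpq (sym (R⊆O p q rpq))
...   | inj₂ (rpq , rqp) = trans rpq (sym (oriented-asym orO (R⊆O q p rqp)))

_≟²_ : DecidableEquality (Fin n × Fin n)
_≟²_ = ≡-dec _≟_ _≟_

removeEdge-removed : ∀ (D : Digraph n) x y → removeEdge D x y x y ≡ false
removeEdge-removed D x y rewrite dec-true (x ≟ x) refl | dec-true (y ≟ y) refl = refl

removeEdge-kept : ∀ (D : Digraph n) → (a , b) ≢ (x , y) → removeEdge D x y a b ≡ D a b
removeEdge-kept {a = a} {b = b} {x = x} {y = y} D ab≢xy with a ≟ x | b ≟ y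
... | yes refl | yes refl = ⊥-elim (ab≢xy refl)
... | yes _    | no _     = refl
... | no _     | _        = refl

removeEdge-⊆ : ∀ (D : Digraph n) x y → removeEdge D x y ⊆ᴰ D
removeEdge-⊆ D x y a b e with (a , b) ≟² (x , y)
... | yes refl  = ⊥-elim (≡true⇒≢false e (removeEdge-removed D x y))
... | no ab≢xy = trans (sym (removeEdge-kept D ab≢xy)) e

removeEdge-loopless : Loopless D → Loopless (removeEdge D x y)
removeEdge-loopless {D = D} ℓ a = ⊆ᴰ-false (removeEdge-⊆ D _ _) (ℓ a)

removeEdge-semicomplete : Semicomplete D → SymEdge D a b → Semicomplete (removeEdge D b a)
removeEdge-semicomplete {D = D} {a = a} {b = b} (ℓ , adj) (dab , _) = removeEdge-loopless {D = D} ℓ , adj′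
  where
  keepsAdjacency : ∀ x y → D x y ≡ true → removeEdge D b a x y ≡ true ⊎ removeEdge D b a y x ≡ true
  keepsAdjacency x y dxy with (x , y) ≟² (b , a)
  ... | yes refl  = inj₂ (trans (removeEdge-kept D (symEdge-≢ ℓ (dab , dxy) ∘ cong proj₁)) dab)
  ... | no xy≢ba = inj₁ (trans (removeEdge-kept D xy≢ba) dxy)
  adj′ : ∀ x y → x ≢ y → removeEdge D b a x y ≡ true ⊎ removeEdge D b a y x ≡ true
  adj′ x y x≢y with adj x y x≢y
  ... | inj₁ dxy = keepsAdjacency x y dxy
  ... | inj₂ dyx = Sum.swap (keepsAdjacency y x dyx)

oc-⊆ : IsOrientationCompletion D O → O ⊆ᴰ D
oc-⊆ {D = D} (none , _) x y oxy with D x y in dxy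
... | true  = refl
... | false = ⊥-elim (≡true⇒≢false oxy (none x y dxy))

oc-adjacent : IsOrientationCompletion D O → D x y ≡ true → O x y ≡ true ⊎ O y x ≡ true
oc-adjacent {D = D} {x = x} {y = y} (_ , single , both) dxy with D y x in dyx
... | false = inj₁ (single x y dxy dyx)
... | true with both x y (dxy , dyx)
...   | inj₁ (oxy , _) = inj₁ oxy
...   | inj₂ (_ , oyx) = inj₂ oyx

oc-oriented : Loopless D → IsOrientationCompletion D O → Oriented O
oc-oriented {O = O} ℓ oc@(none , _ , both) = (λ x → none x x (ℓ x)) , noSym
  where
  noSym : ∀ x y → ¬ SymEdge O x y
  noSym x y (oxy , oyx) with both x y (oc-⊆ oc x y oxy , oc-⊆ oc y x oyx)
  ... | inj₁ (_ , oyx′) = ≡true⇒≢false oyx oyx′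
  ... | inj₂ (oxy′ , _) = ≡true⇒≢false oxy oxy′

orientUpward : Digraph n → Digraph n
orientUpward D p q = D p q ∧ (not (D q p) ∨ does (p <? q))

<-oneWay : x ≢ y → OneWay (λ p q → does (p <? q)) x y
<-oneWay {x = x} {y = y} x≢y with <-cmp x y
... | tri< x<y _ y≮x = inj₁ (dec-true (x <? y) x<y , dec-false (y <? x) y≮x)
... | tri≈ _ x≡y _   = ⊥-elim (x≢y x≡y)
... | tri> x≮y _ y<x = inj₂ (dec-false (x <? y) x≮y , dec-true (y <? x) y<x)

orientUpward-oc : Loopless D → IsOrientationCompletion D (orientUpward D)
orientUpward-oc {D = D} ℓ = none , single , both
  where
  none : ∀ p q → D p q ≡ false → orientUpward D p q ≡ false
  none p q dpq rewrite dpq = refl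
  single : ∀ p q → D p q ≡ true → D q p ≡ false → orientUpward D p q ≡ true
  single p q dpq dqp rewrite dpq | dqp = refl
  both : ∀ p q → SymEdge D p q → OneWay (orientUpward D) p q
  both p q s@(dpq , dqp) rewrite dpq | dqp = <-oneWay (symEdge-≢ {D = D} ℓ s)

oc-removeEdge⁺ : SymEdge D x y → IsOrientationCompletion D O → O y x ≡ false →
                 IsOrientationCompletion (removeEdge D y x) O
oc-removeEdge⁺ {D = D} {x = x} {y = y} {O = O} sxy (none , single , both) oyx = none′ , single′ , both′
  where
  oxy : O x y ≡ true
  oxy with both x y sxy
  ... | inj₁ (oxy , _)   = oxy
  ... | inj₂ (_ , oyx′) = ⊥-elim (≡true⇒≢false oyx′ oyx)
  none′ : ∀ p q → removeEdge D y x p q ≡ false → O p q ≡ false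
  none′ p q e with (p , q) ≟² (y , x)
  ... | yes refl  = oyx
  ... | no pq≢yx = none p q (trans (sym (removeEdge-kept D pq≢yx)) e)
  single′ : ∀ p q → removeEdge D y x p q ≡ true → removeEdge D y x q p ≡ false → O p q ≡ true
  single′ p q e₁ e₂ with (p , q) ≟² (y , x) | (q , p) ≟² (y , x)
  ... | yes refl  | _         = ⊥-elim (≡true⇒≢false e₁ (removeEdge-removed D y x))
  ... | no _      | yes refl  = oxy
  ... | no pq≢yx | no qp≢yx =
    single p q (trans (sym (removeEdge-kept D pq≢yx)) e₁) (trans (sym (removeEdge-kept D qp≢yx)) e₂)
  both′ : ∀ p q → SymEdge (removeEdge D y x) p q → OneWay O p q
  both′ p q (e₁ , e₂) = both p q (removeEdge-⊆ D y x p q e₁ , removeEdge-⊆ D y x q p e₂)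

oc-removeEdge⁻ : x ≢ y → SymEdge D x y → IsOrientationCompletion (removeEdge D y x) O →
                 IsOrientationCompletion D O × O y x ≡ false
oc-removeEdge⁻ {x = x} {y = y} {D = D} {O = O} x≢y (dxy , dyx) (none , single , both) =
  (none′ , single′ , both′) , oyx
  where
  xy≢yx : (x , y) ≢ (y , x)
  xy≢yx = x≢y ∘ cong proj₁
  oyx : O y x ≡ false
  oyx = none y x (removeEdge-removed D y x)
  oxy : O x y ≡ true
  oxy = single x y (trans (removeEdge-kept D xy≢yx) dxy) (removeEdge-removed D y x)
  none′ : ∀ p q → D p q ≡ false → O p q ≡ false
  none′ p q e = none p q (⊆ᴰ-false (removeEdge-⊆ D y x) e)
  single′ : ∀ p q → D p q ≡ true → D q p ≡ false → O p q ≡ true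
  single′ p q e₁ e₂ with (p , q) ≟² (y , x)
  ... | yes refl  = ⊥-elim (≡true⇒≢false dxy e₂)
  ... | no pq≢yx = single p q (trans (removeEdge-kept D pq≢yx) e₁) (⊆ᴰ-false (removeEdge-⊆ D y x) e₂)
  both′ : ∀ p q → SymEdge D p q → OneWay O p q
  both′ p q (e₁ , e₂) with (p , q) ≟² (y , x) | (q , p) ≟² (y , x)
  ... | yes refl  | _         = inj₂ (oyx , oxy)
  ... | no _      | yes refl  = inj₁ (oxy , oyx)
  ... | no pq≢yx | no qp≢yx =
    both p q (trans (removeEdge-kept D pq≢yx) e₁ , trans (removeEdge-kept D qp≢yx) e₂)

oc-avoiding : Loopless D → D u v ≡ false ⊎ SymEdge D u v →
              Σ (Digraph _) λ O → IsOrientationCompletion D O × O u v ≡ false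
oc-avoiding {D = D} ℓ (inj₁ duv) = orientUpward D , oc , proj₁ oc _ _ duv
  where
  oc : IsOrientationCompletion D (orientUpward D)
  oc = orientUpward-oc ℓ
oc-avoiding {D = D} {u = u} {v = v} ℓ (inj₂ suv) = orientUpward (removeEdge D u v) , restricted
  where
  restricted : IsOrientationCompletion D (orientUpward (removeEdge D u v)) ×
               orientUpward (removeEdge D u v) u v ≡ false
  restricted = oc-removeEdge⁻ (symEdge-≢ {D = D} ℓ (Product.swap suv)) (Product.swap suv)
                              (orientUpward-oc (removeEdge-loopless {D = D} ℓ))

embeds-trans : ∀ {k l} {S : Digraph k} {T : Digraph l} {U : Digraph n} →
               InducedEmbeds S T → InducedEmbeds T U → InducedEmbeds S U
embeds-trans (f , f-inj , f-eq) (g , g-inj , g-eq) =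
  g ∘ f , f-inj ∘ g-inj , λ i j i≢j → trans (f-eq i j i≢j) (g-eq (f i) (f j) (i≢j ∘ f-inj))

FFree-inducedSubgraph : ∀ {S : Digraph k} {T : Digraph n} → InducedEmbeds S T → FFree F T → FFree F S
FFree-inducedSubgraph {S = S} {T = T} S↪T =
  All.map λ ¬U↪T U↪S → ¬U↪T (embeds-trans {T = S} {U = T} U↪S S↪T)

pullback : Digraph n → (Fin k → Fin n) → Digraph k
pullback T τ i j = T (τ i) (τ j)

pullback-embeds : (τ : Fin k → Fin n) → Injective _≡_ _≡_ τ → InducedEmbeds (pullback T τ) T
pullback-embeds τ τ-inj = τ , τ-inj , λ _ _ _ → refl

pullback-tournament : Oriented O → (g : Fin k → Fin n) → Injective _≡_ _≡_ g →
                      (∀ i j → i ≢ j → O (g i) (g j) ≡ true ⊎ O (g j) (g i) ≡ true) →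
                      IsTournament (pullback O g)
pullback-tournament (ℓ , noSym) g g-inj adj =
  ((ℓ ∘ g) , λ i j → noSym (g i) (g j)) , adj

tournament-pullback : IsTournament T → (τ : Fin k → Fin n) → Injective _≡_ _≡_ τ →
                      IsTournament (pullback T τ)
tournament-pullback (orT , adj) τ τ-inj =
  pullback-tournament orT τ τ-inj λ i j i≢j → adj (τ i) (τ j) (i≢j ∘ τ-inj)

transpose-injective : ∀ (i j : Fin n) → Injective _≡_ _≡_ (PC.transpose i j)
transpose-injective i j e =
  trans (sym (PC.transpose-inverse j i)) (trans (cong (PC.transpose j i) e) (PC.transpose-inverse j i))

transpose-matchˡ : ∀ (i j : Fin n) → PC.transpose i j i ≡ j
transpose-matchˡ i j rewrite dec-true (i ≟ i) refl = refl

transpose-fixed : ∀ (i j : Fin n) → a ≢ i → a ≢ j → PC.transpose i j a ≡ a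
transpose-fixed {a = a} i j a≢i a≢j rewrite dec-false (a ≟ i) a≢i | dec-false (a ≟ j) a≢j = refl

relabelling : ∀ {u v p q : Fin n} → u ≢ v → p ≢ q →
              Σ (Fin n → Fin n) λ τ → Injective _≡_ _≡_ τ × τ u ≡ p × τ v ≡ q
relabelling {n} {u} {v} {p} {q} u≢v p≢q =
  τ₂ ∘ τ₁ , transpose-injective u p ∘ transpose-injective v′ q , τu , transpose-matchˡ v′ q
  where
  τ₁ τ₂ : Fin n → Fin n
  τ₁ = PC.transpose u p
  v′ : Fin n
  v′ = τ₁ v
  τ₂ = PC.transpose v′ q
  p≢v′ : p ≢ v′
  p≢v′ p≡v′ = u≢v (transpose-injective u p (trans (transpose-matchˡ u p) p≡v′))
  τu : τ₂ (τ₁ u) ≡ p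
  τu = trans (cong τ₂ (transpose-matchˡ u p)) (transpose-fixed v′ q p≢v′ p≢q)

forced-by-¬HasFFreeOC : SymEdge D x y → ¬ HasFFreeOC F (removeEdge D y x) →
                        ∀ O → IsOrientationCompletion D O → FFree F O → O y x ≡ true
forced-by-¬HasFFreeOC {D = D} {x = x} {y = y} sxy noFreeOC O oc free with O y x in oyx
... | true  = refl
... | false = ⊥-elim (noFreeOC (O , oc-removeEdge⁺ sxy oc oyx , free))

free-sym : Free F D x y → Free F D y x
free-sym (sxy , hasxy , hasyx) = Product.swap sxy , hasyx , hasxy

complete : ∀ n → Digraph n
complete n a b = not (does (a ≟ b))

complete-loopless : Loopless (complete n)
complete-loopless a rewrite dec-true (a ≟ a) refl = refl

complete-≢ : a ≢ b → complete n a b ≡ true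
complete-≢ {a = a} {b = b} a≢b rewrite dec-false (a ≟ b) a≢b = refl

complete-false⇒≡ : complete n a b ≡ false → a ≡ b
complete-false⇒≡ {a = a} {b = b} e with a ≟ b
... | yes a≡b = a≡b

complete-symEdge : a ≢ b → SymEdge (complete n) a b
complete-symEdge a≢b = complete-≢ a≢b , complete-≢ (a≢b ∘ sym)

loopless-⊆-complete : Loopless D → D ⊆ᴰ complete n
loopless-⊆-complete {D = D} ℓ a b dab = complete-≢ {a = a} {b = b} λ { refl → ≡true⇒≢false dab (ℓ a) }

complete-semicomplete : Semicomplete (complete n)
complete-semicomplete = complete-loopless , λ _ _ a≢b → inj₁ (complete-≢ a≢b)

tournament-oc-complete : IsTournament O → IsOrientationCompletion (complete n) O
tournament-oc-complete {O = O} tO = none , single , both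
  where
  none : ∀ a b → complete _ a b ≡ false → O a b ≡ false
  none a b e with complete-false⇒≡ {a = a} {b = b} e
  ... | refl = proj₁ (proj₁ tO) a
  single : ∀ a b → complete _ a b ≡ true → complete _ b a ≡ false → O a b ≡ true
  single a b e₁ e₂ with complete-false⇒≡ {a = b} {b = a} e₂
  ... | refl = ⊥-elim (≡true⇒≢false e₁ (complete-loopless a))
  both : ∀ a b → SymEdge (complete _) a b → OneWay O a b
  both a b s = tournament-oneWay tO (symEdge-≢ complete-loopless s)

-- Relabelling T moves its edge p q onto any prescribed pair, so every orientation of a single
-- pair extends to an F-free tournament.
complete-removeEdge-hasFFreeOC : {T : Digraph n} → IsTournament T → FFree F T → ∀ {p q} → T p q ≡ true →
                                 x ≢ y → HasFFreeOC F (removeEdge (complete n) y x)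
complete-removeEdge-hasFFreeOC {n = n} {F = F} {x = x} {y = y} {T = T} tT free {p} {q} tpq x≢y
  with relabelling x≢y p≢q
  where
  p≢q : p ≢ q
  p≢q refl = ≡true⇒≢false tpq (proj₁ (proj₁ tT) p)
... | τ , τ-inj , τx , τy =
  relabelled , oc-removeEdge⁺ (complete-symEdge x≢y) (tournament-oc-complete tO) oyx ,
  FFree-inducedSubgraph {F = F} {T = T} (pullback-embeds {T = T} τ τ-inj) free
  where
  relabelled : Digraph n
  relabelled = pullback T τ
  tO : IsTournament relabelled
  tO = tournament-pullback tT τ τ-inj
  oxy : relabelled x y ≡ true
  oxy rewrite τx | τy = tpq
  oyx : relabelled y x ≡ false
  oyx = oriented-asym (proj₁ tO) oxy

cond1⇒cond2 : Cond1 F m → Cond2 F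
cond1⇒cond2 {F = F} cond1 n D ℓ = mk⇔ allFree λ allFree′ → orientUpward D , oc , allFree′ _ oc
  where
  oc : IsOrientationCompletion D (orientUpward D)
  oc = orientUpward-oc ℓ
  allFree : HasFFreeOC F D → ∀ O → IsOrientationCompletion D O → FFree F O
  allFree (O₁ , oc₁ , free₁) O₂ oc₂ = Equivalence.from (cond1 n O₂ (oc-oriented ℓ oc₂)) noTournament
    where
    or₁ : Oriented O₁
    or₁ = oc-oriented ℓ oc₁
    noTournament : ∀ T → IsTournament T → ¬ InducedEmbeds T O₂
    noTournament T (_ , adjT) (g , g-inj , g-eq) =
      Equivalence.to (cond1 n O₁ or₁) free₁ (pullback O₁ g) (pullback-tournament or₁ g g-inj adj)
        (pullback-embeds {T = O₁} g g-inj)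
      where
      adj₁ : ∀ i j → i ≢ j → T i j ≡ true → O₁ (g i) (g j) ≡ true ⊎ O₁ (g j) (g i) ≡ true
      adj₁ i j i≢j tij = oc-adjacent oc₁ (oc-⊆ oc₂ _ _ (trans (sym (g-eq i j i≢j)) tij))
      adj : ∀ i j → i ≢ j → O₁ (g i) (g j) ≡ true ⊎ O₁ (g j) (g i) ≡ true
      adj i j i≢j with adjT i j i≢j
      ... | inj₁ tij = adj₁ i j i≢j tij
      ... | inj₂ tji = Sum.swap (adj₁ j i (i≢j ∘ sym) tji)

symEdge-removeEdge : ∀ (D : Digraph n) y x u v → SymEdge D u v →
                     (v , u) ≡ (y , x) ⊎ (removeEdge D y x u v ≡ false ⊎ SymEdge (removeEdge D y x) u v)
symEdge-removeEdge D y x u v (duv , dvu)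
  with (u , v) ≟² (y , x) | (v , u) ≟² (y , x)
... | yes refl  | _         = inj₂ (inj₁ (removeEdge-removed D y x))
... | no _      | yes vu≡yx = inj₁ vu≡yx
... | no uv≢yx | no vu≢yx =
  inj₂ (inj₂ (trans (removeEdge-kept D uv≢yx) duv , trans (removeEdge-kept D vu≢yx) dvu))

allFree-¬forced : Loopless D → (∀ O → IsOrientationCompletion D O → FFree F O) →
                  D u v ≡ false ⊎ SymEdge D u v →
                  ¬ (∀ O → IsOrientationCompletion D O → FFree F O → O u v ≡ true)
allFree-¬forced {D = D} ℓ allFree avoidable forced with oc-avoiding {D = D} ℓ avoidable
... | O , oc , ouv = ≡true⇒≢false (forced O oc (allFree O oc)) ouv

cond2⇒cond3 : Cond2 F → Cond3 F
cond2⇒cond3 {F = F} cond2 n D ℓ x y u v (freeXY , (suv , _) , forced)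
  with symEdge-removeEdge D y x u v suv
... | inj₁ refl      = refl , refl
... | inj₂ avoidable = ⊥-elim (allFree-¬forced {D = removeEdge D y x} ℓ′ allFree avoidable forced)
  where
  ℓ′ : Loopless (removeEdge D y x)
  ℓ′ = removeEdge-loopless {D = D} ℓ
  allFree : ∀ O → IsOrientationCompletion (removeEdge D y x) O → FFree F O
  allFree = Equivalence.to (cond2 n (removeEdge D y x) ℓ′) (proj₂ (proj₂ freeXY))

cond3⇒cond4 : Cond3 F → Cond4 F m
cond3⇒cond4 {m = m} cond3 D (ℓ , _) = cond3 m D ℓ

module _ {F : Family} {m : ℕ} (cond4 : Cond4 F m) where

  -- Freeness of an edge is not decidable, so it is only tracked up to double negation;
  -- this suffices because the argument ends in a contradiction.
  FreeSymEdges : Digraph m → Set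
  FreeSymEdges D = ∀ x y → SymEdge D x y → ¬ ¬ Free F D x y

  -- If D′ - (y, x) had no F-free orientation completion (where D′ = D - (b, a)), then (a, b)
  -- would force (y, x) in D, so (a, b) = (y, x) by (4), contradicting that x y is symmetric in D′.
  removeEdge-freeSymEdges : {D : Digraph m} → Semicomplete D → FreeSymEdges D → Free F D a b →
                            FreeSymEdges (removeEdge D b a)
  removeEdge-freeSymEdges {a = a} {b = b} {D = D} sc free freeAB x y sxy notFree =
    avoidable x y sxy λ h₁ → avoidable y x (Product.swap sxy) λ h₂ → notFree (sxy , h₂ , h₁)
    where
    D′ : Digraph m
    D′ = removeEdge D b a
    avoidable : ∀ x y → SymEdge D′ x y → ¬ ¬ HasFFreeOC F (removeEdge D′ y x)
    avoidable x y s′@(d′xy , d′yx) noFreeOC =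
      free x y (removeEdge-⊆ D b a x y d′xy , removeEdge-⊆ D b a y x d′yx) ¬freeXY
      where
      ¬freeXY : ¬ Free F D x y
      ¬freeXY freeXY with cond4 D sc a b y x (freeAB , free-sym freeXY , forced-by-¬HasFFreeOC s′ noFreeOC)
      ... | refl , refl = ≡true⇒≢false d′xy (removeEdge-removed D x y)

  module _ (R : Digraph m) (tR : IsTournament R) where

    Good : Digraph m → Set
    Good D = Semicomplete D × R ⊆ᴰ D × FreeSymEdges D × ¬ ¬ HasFFreeOC F D

    orient : Fin m × Fin m → Digraph m → Digraph m
    orient (a , b) D with R a b | D b a
    ... | true  | true  = removeEdge D b a
    ... | true  | false = D
    ... | false | _     = D

    orient-⊆ : ∀ ab D → orient ab D ⊆ᴰ D
    orient-⊆ (a , b) D with R a b | D b a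
    ... | true  | true  = removeEdge-⊆ D b a
    ... | true  | false = λ _ _ → id
    ... | false | _     = λ _ _ → id

    orient-orients : ∀ D → R a b ≡ true → orient (a , b) D b a ≡ false
    orient-orients {a = a} {b = b} D rab with R a b | D b a in dba
    ... | true  | true  = removeEdge-removed D b a
    ... | true  | false = dba
    ... | false | _     = ⊥-elim (≡true⇒≢false rab refl)

    orient-good : ∀ ab D → Good D → ¬ ¬ Good (orient ab D)
    orient-good (a , b) D good@(sc , R⊆D , free , _) with R a b in rab | D b a in dba
    ... | true  | true  = λ notGood → free a b sab λ freeAB →
      notGood (removeEdge-semicomplete sc sab , R⊆D′ , removeEdge-freeSymEdges sc free freeAB ,
               λ none → none (proj₂ (proj₂ freeAB)))
      where
      sab : SymEdge D a b
      sab = R⊆D a b rab , dba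
      R⊆D′ : R ⊆ᴰ removeEdge D b a
      R⊆D′ p q rpq with (p , q) ≟² (b , a)
      ... | yes refl  = ⊥-elim (proj₂ (proj₁ tR) a b (rab , rpq))
      ... | no pq≢ba = trans (removeEdge-kept D pq≢ba) (R⊆D p q rpq)
    ... | true  | false = λ notGood → notGood good
    ... | false | _     = λ notGood → notGood good

    orientAll : List (Fin m × Fin m) → Digraph m → Digraph m
    orientAll L D = foldr orient D L

    orientAll-good : ∀ L D → Good D → ¬ ¬ Good (orientAll L D)
    orientAll-good []       D good = λ notGood → notGood good
    orientAll-good (ab ∷ L) D good =
      λ notGood → orientAll-good L D good λ good′ → orient-good ab (orientAll L D) good′ notGood

    orientAll-orients : ∀ L D → (a , b) ∈ L → R a b ≡ true → orientAll L D b a ≡ false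
    orientAll-orients (_ ∷ L) D (here refl) rab = orient-orients (orientAll L D) rab
    orientAll-orients (ab ∷ L) D (there mem) rab =
      ⊆ᴰ-false (orient-⊆ ab (orientAll L D)) (orientAll-orients L D mem rab)

    complete-good : ∀ {T : Digraph m} {p q} → IsTournament T → FFree F T → T p q ≡ true →
                    Good (complete m)
    complete-good {T = T} tT freeT tpq =
      complete-semicomplete , loopless-⊆-complete {D = R} (proj₁ (proj₁ tR)) , free ,
      λ none → none (T , tournament-oc-complete tT , freeT)
      where
      free : FreeSymEdges (complete m)
      free x y sxy notFree = notFree
        (sxy , complete-removeEdge-hasFFreeOC tT freeT tpq (x≢y ∘ sym) ,
         complete-removeEdge-hasFFreeOC tT freeT tpq x≢y)
        where
        x≢y : x ≢ y
        x≢y = symEdge-≢ {D = complete m} complete-loopless sxy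

    good⇒FFree : {D : Digraph m} → Good D → (∀ p q → R p q ≡ true → D q p ≡ false) → ¬ ¬ FFree F R
    good⇒FFree {D = D} ((ℓ , _) , R⊆D , _ , hasFreeOC) orients = ¬¬-map R-free hasFreeOC
      where
      R-free : HasFFreeOC F D → FFree F R
      R-free (O , oc@(_ , single , _) , freeO) =
        FFree-inducedSubgraph {F = F} {T = O}
          (id , id , λ p q _ → tournament-⊆-oriented tR (oc-oriented ℓ oc) R⊆O p q) freeO
        where
        R⊆O : R ⊆ᴰ O
        R⊆O p q rpq = single p q (R⊆D p q rpq) (orients p q rpq)

    FFree-transfer : ∀ {T : Digraph m} {p q} → IsTournament T → FFree F T → T p q ≡ true → ¬ ¬ FFree F R
    FFree-transfer tT freeT tpq notFree =
      orientAll-good allPairs (complete m) (complete-good tT freeT tpq) λ good →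
        good⇒FFree good (λ p q rpq →
          orientAll-orients allPairs (complete m) (∈-cartesianProduct⁺ (∈-allFin p) (∈-allFin q)) rpq)
        notFree
      where
      allPairs : List (Fin m × Fin m)
      allPairs = cartesianProduct (allFin m) (allFin m)

noSmallTournament⇒FFree : All (λ U → IsTournament (proj₂ U)) F → All (λ U → m ≤ proj₁ U) F →
                          (∀ (T : Digraph m) → IsTournament T → ¬ InducedEmbeds T O) → FFree F O
noSmallTournament⇒FFree {m = m} {O = O} tournaments large noSmall = All.zipWith restrict (tournaments , large)
  where
  restrict : ∀ {U} → IsTournament (proj₂ U) × m ≤ proj₁ U → ¬ InducedEmbeds (proj₂ U) O
  restrict {k , U} (tU , m≤k) U↪O =
    noSmall (pullback U ι) (tournament-pullback tU ι ι-inj)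
      (embeds-trans {U = O} (pullback-embeds {T = U} ι ι-inj) U↪O)
    where
    ι : Fin m → Fin k
    ι i = inject≤ i m≤k
    ι-inj : Injective _≡_ _≡_ ι
    ι-inj = inject≤-injective m≤k m≤k _ _

cond4⇒cond1 : All (λ U → IsTournament (proj₂ U) × 2 ≤ proj₁ U) F → Any (λ U → proj₁ U ≡ m) F →
              All (λ U → m ≤ proj₁ U) F → Cond4 F m → Cond1 F m
cond4⇒cond1 {F = F} tournaments orderM large cond4 n O _ =
  mk⇔ noSmall (noSmallTournament⇒FFree {O = O} (All.map proj₁ tournaments) large)
  where
  noSmall : FFree F O → ∀ T → IsTournament T → ¬ InducedEmbeds T O
  noSmall freeO T tT T↪O with find orderM
  ... | (_ , R) , R∈F , refl with All.lookup tournaments R∈F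
  ...   | tR , 2≤m with tournament-edge tT 2≤m
  ...     | p , q , tpq =
    FFree-transfer cond4 R tR tT (FFree-inducedSubgraph {F = F} {T = O} T↪O freeO) tpq
      λ freeR → All.lookup freeR R∈F (id , id , λ _ _ _ → refl)

lemma4p3 : (F : Family) → F ≢ [] →
    All (λ T → IsTournament (proj₂ T) × 2 ≤ proj₁ T) F →
    (m : ℕ) → Any (λ T → proj₁ T ≡ m) F → All (λ T → m ≤ proj₁ T) F →
    (Cond1 F m ⇔ Cond2 F) × (Cond1 F m ⇔ Cond3 F) × (Cond1 F m ⇔ Cond4 F m)
-- F ≢ [] is implied by the Any hypothesis.
lemma4p3 F _ tournaments m orderM large =
  mk⇔ 1⇒2 (4⇒1 ∘ 3⇒4 ∘ 2⇒3) ,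
  mk⇔ (2⇒3 ∘ 1⇒2) (4⇒1 ∘ 3⇒4) ,
  mk⇔ (3⇒4 ∘ 2⇒3 ∘ 1⇒2) 4⇒1
  where
  1⇒2 : Cond1 F m → Cond2 F
  1⇒2 = cond1⇒cond2
  2⇒3 : Cond2 F → Cond3 F
  2⇒3 = cond2⇒cond3
  3⇒4 : Cond3 F → Cond4 F m
  3⇒4 = cond3⇒cond4
  4⇒1 : Cond4 F m → Cond1 F m
  4⇒1 = cond4⇒cond1 tournaments orderM large
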